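{- If $[\mathcal{Q},\mathcal{QV},M]\in\mathsf{EQT}$ and $[\mathcal{Q},\mathcal{QV},M]\to_{\mathscr{Q}}[\mathcal{Q}',\mathcal{QV}',M']$, then $[\mathcal{Q}',\mathcal{QV}',M']\in\mathsf{EQT}$.
   Context: The Q-calculus. Terms: classical variables $x$; quantum variables $r$; patterns $\pi::=x\mid\langle x_1,\dots,x_n\rangle$; constants $0,1$ and symbols $U_i$ for a fixed effective enumeration $(\mathbf{U}_i)$ of computable unitary operators on $\mathbb{C}^{2^{n_i}}$; terms $M::=x\mid r\mid\ !M\mid C\mid \mathtt{new}(M)\mid (M_1)M_2\mid\langle M_1,\dots,M_n\rangle\ (n\ge2)\mid \lambda!x.M\mid\lambda\pi.M$ modulo $\alpha$-conversion. Well-formedness of judgements $\Gamma\vdash M$: axioms $\vdash C$, $r\vdash r$, $x\vdash x$; $\Gamma\vdash M\Rightarrow\Gamma,!x\vdash M$; $\Gamma,!x,!y\vdash M\Rightarrow\Gamma,!z\vdash M\{z/x,z/y\}$; $!\Gamma\vdash M\Rightarrow!\Gamma\vdash!M$; $\Gamma,x\vdash M\Rightarrow\Gamma,!x\vdash M$; $\Gamma,x_1,\dots,x_k\vdash M\Rightarrow\Gamma,\langle x_1,\dots,x_k\rangle\vdash M$; $\Gamma_i\vdash M_i\Rightarrow\Gamma_1,\dots,\Gamma_k\vdash\langle M_1,\dots,M_k\rangle$; $\Gamma\vdash M\Rightarrow\Gamma\vdash\mathtt{new}(M)$; $\Gamma,\pi\vdash M\Rightarrow\Gamma\vdash\lambda\pi.M$;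 $\Gamma,!x\vdash M\Rightarrow\Gamma\vdash\lambda!x.M$; $\Gamma_1\vdash M_1,\Gamma_2\vdash M_2\Rightarrow\Gamma_1,\Gamma_2\vdash(M_1)M_2$. Configurations $[\mathcal{Q},\mathcal{QV},M]$ ($\mathcal{QV}$ finite set of quantum variables containing those of $M$, $\mathcal{Q}$ in the Hilbert space of functions $\{0,1\}^{\mathcal{QV}}\to\mathbb{C}$), modulo bijective renaming of quantum variables, assumed well formed. Labelled reductions: ($\mathsf{Uq}$) $[\mathcal{Q},\mathcal{QV},U\langle r_1,\dots,r_n\rangle]\to[\mathbf{U}_{\langle\langle r_1,\dots,r_n\rangle\rangle}\mathcal{Q},\mathcal{QV},\langle r_1,\dots,r_n\rangle]$ (apply $\mathbf{U}$ to qubits $r_1,\dots,r_n$); ($\mathsf{new}$) $[\mathcal{Q},\mathcal{QV},\mathtt{new}(c)]\to[\mathcal{Q}\otimes|r\mapsto c\rangle,\mathcal{QV}\cup\{r\},r]$, $c\in\{0,1\}$, $r$ fresh; and with $\mathcal{Q},\mathcal{QV}$ unchanged ($\mathsf{l.\beta}$) $(\lambda x.M)N\to M\{N/x\}$, ($\mathsf{q.\beta}$) $(\lambda\langle x_1,\dots,x_n\rangle.M)\langle r_1,\dots,r_n\rangle\to M\{r_i/x_i\}_i$, ($\mathsf{c.\beta}$) $(\lambda!x.M)!N\to M\{N/x\}$, ($\mathsf{l.cm}$) $L((\lambda\pi.M)N)\to(\lambda\pi.LM)N$, ($\mathsf{r.cm}$) $((\lambda\pi.M)N)L\to(\lambda\pi.ML)N$;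 closed (preserving labels) under tuple components, both sides of application, and the body of $\lambda\pi.(\cdot)$ (not inside $!M$). Let $\mathscr{Q}=\{\mathsf{Uq},\mathsf{q.\beta}\}$ and $\to_{\mathscr{Q}}$ the union of the reductions with these labels. A configuration $C$ is essentially quantum, $C\in\mathsf{EQT}$, if $\alpha\in\mathscr{Q}$ whenever $C\xrightarrow{\alpha}C'$. -}

module Defs where

open import Level using (0ℓ)
open import Algebra.Bundles using (CommutativeRing)
open import Data.Nat using (ℕ; zero; suc; _+_; _≤_)
open import Data.Bool using (Bool; true; false; if_then_else_; _xor_)
open import Data.List using (List; []; _∷_; _++_; length; map)
open import Data.List.Membership.Propositional using (_∈_; _∉_)
open import Data.List.Relation.Unary.Any using (here; there)
open import Data.List.Relation.Unary.Unique.Propositional using (Unique)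
open import Data.Vec using (Vec; []; _∷_; lookup; tabulate; toList)
open import Data.Fin using (Fin)
open import Data.Product using (Σ; ∃; _×_; _,_)
open import Data.Sum using (_⊎_)
open import Relation.Nullary using (¬_; yes; no)
open import Relation.Binary.PropositionalEquality using (_≡_; _≢_; refl)
import Data.Nat as N

-- Syntax of the Q-calculus (classical variables as de Bruijn indices,
-- quantum variables as names r ∈ ℕ).

-- Patterns bound by λπ : a single linear variable x, or a tuple
-- ⟨x₁,…,xₖ⟩ (binding k variables; inside the body index j < k is x_{j+1}).
data Pat : Set where
  pvar : Pat
  ptup : ℕ → Pat

arityP : Pat → ℕ
arityP pvar     = 1
arityP (ptup k) = k

data Term : Set where
  var  : ℕ → Term
  qvar : ℕ → Term
  bang : Term → Term
  c0   : Term
  c1   : Term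
  gate : ℕ → Term
  new  : Term → Term
  app  : Term → Term → Term
  tup  : List Term → Term      -- ⟨M₁,…,Mₙ⟩  (n ≥ 2 enforced by well-formedness)
  lam! : Term → Term
  lam  : Pat → Term → Term

liftr : ℕ → (ℕ → ℕ) → ℕ → ℕ
liftr zero    ρ i       = ρ i
liftr (suc k) ρ zero    = zero
liftr (suc k) ρ (suc i) = suc (liftr k ρ i)

mutual
  ren : (ℕ → ℕ) → Term → Term
  ren ρ (var i)   = var (ρ i)
  ren ρ (qvar r)  = qvar r
  ren ρ (bang M)  = bang (ren ρ M)
  ren ρ c0        = c0
  ren ρ c1        = c1
  ren ρ (gate i)  = gate i
  ren ρ (new M)   = new (ren ρ M)
  ren ρ (app M N) = app (ren ρ M) (ren ρ N)
  ren ρ (tup Ms)  = tup (renL ρ Ms)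
  ren ρ (lam! M)  = lam! (ren (liftr 1 ρ) M)
  ren ρ (lam π M) = lam π (ren (liftr (arityP π) ρ) M)

  renL : (ℕ → ℕ) → List Term → List Term
  renL ρ []       = []
  renL ρ (M ∷ Ms) = ren ρ M ∷ renL ρ Ms

lifts : ℕ → (ℕ → Term) → ℕ → Term
lifts zero    σ i       = σ i
lifts (suc k) σ zero    = var zero
lifts (suc k) σ (suc i) = ren suc (lifts k σ i)

mutual
  sub : (ℕ → Term) → Term → Term
  sub σ (var i)   = σ i
  sub σ (qvar r)  = qvar r
  sub σ (bang M)  = bang (sub σ M)
  sub σ c0        = c0
  sub σ c1        = c1
  sub σ (gate i)  = gate i
  sub σ (new M)   = new (sub σ M)
  sub σ (app M N) = app (sub σ M) (sub σ N)
  sub σ (tup Ms)  = tup (subL σ Ms)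
  sub σ (lam! M)  = lam! (sub (lifts 1 σ) M)
  sub σ (lam π M) = lam π (sub (lifts (arityP π) σ) M)

  subL : (ℕ → Term) → List Term → List Term
  subL σ []       = []
  subL σ (M ∷ Ms) = sub σ M ∷ subL σ Ms

-- M{N/x} where x is the variable bound by the outermost binder (index 0)
sub0 : Term → ℕ → Term
sub0 N zero    = N
sub0 N (suc i) = var i

qsub : List ℕ → ℕ → Term
qsub []       i       = var i
qsub (r ∷ rs) zero    = qvar r
qsub (r ∷ rs) (suc i) = qsub rs i

qtuple : List ℕ → Term
qtuple rs = tup (map qvar rs)

qargs : List ℕ → Term
qargs (r ∷ []) = qvar r
qargs rs       = qtuple rs

-- Well-formedness judgement Γ ⊢ M (de Bruijn / usage presentation)
-- Mark of a classical variable: 𝟘 (absent), 𝟙 (linear x), ω (!x).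

data Mark : Set where
  𝟘 𝟙 ω : Mark

record Ctx : Set where
  constructor ctx
  field
    cl : ℕ → Mark
    qu : ℕ → Bool
open Ctx public

_◂_ : Mark → Ctx → Ctx
m ◂ ctx c q = ctx (λ { zero → m ; (suc i) → c i }) q

_◂^_ : ℕ → Ctx → Ctx
zero  ◂^ Γ = Γ
suc k ◂^ Γ = 𝟙 ◂ (k ◂^ Γ)

-- variables that may be discarded (weakening only for !x)
data Disposable : Mark → Set where
  d𝟘 : Disposable 𝟘
  dω : Disposable ω

data Usable : Mark → Set where
  u𝟙 : Usable 𝟙
  uω : Usable ω

-- Γ = Γ₁,Γ₂ (with contraction of !-variables)
data SplitM : Mark → Mark → Mark → Set where
  s𝟘  : SplitM 𝟘 𝟘 𝟘
  s𝟙l : SplitM 𝟙 𝟙 𝟘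
  s𝟙r : SplitM 𝟙 𝟘 𝟙
  sω  : SplitM ω ω ω

data SplitQ : Bool → Bool → Bool → Set where
  sff : SplitQ false false false
  stl : SplitQ true true false
  str : SplitQ true false true

_≔_⊕_ : Ctx → Ctx → Ctx → Set
Γ ≔ Γ₁ ⊕ Γ₂ = (∀ i → SplitM (cl Γ i) (cl Γ₁ i) (cl Γ₂ i))
            × (∀ r → SplitQ (qu Γ r) (qu Γ₁ r) (qu Γ₂ r))

BangCtx : Ctx → Set
BangCtx Γ = (∀ i → Disposable (cl Γ i)) × (∀ r → qu Γ r ≡ false)

mutual
  data _⊢_ : Ctx → Term → Set where
    wf-var  : ∀ {Γ i} → Usable (cl Γ i) → (∀ j → j ≢ i → Disposable (cl Γ j))
            → (∀ r → qu Γ r ≡ false) → Γ ⊢ var i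
    wf-qvar : ∀ {Γ r} → (∀ j → Disposable (cl Γ j)) → qu Γ r ≡ true
            → (∀ r' → r' ≢ r → qu Γ r' ≡ false) → Γ ⊢ qvar r
    wf-c0   : ∀ {Γ} → BangCtx Γ → Γ ⊢ c0
    wf-c1   : ∀ {Γ} → BangCtx Γ → Γ ⊢ c1
    wf-gate : ∀ {Γ i} → BangCtx Γ → Γ ⊢ gate i
    wf-bang : ∀ {Γ M} → BangCtx Γ → Γ ⊢ M → Γ ⊢ bang M
    wf-new  : ∀ {Γ M} → Γ ⊢ M → Γ ⊢ new M
    wf-app  : ∀ {Γ Γ₁ Γ₂ M N} → Γ ≔ Γ₁ ⊕ Γ₂ → Γ₁ ⊢ M → Γ₂ ⊢ N → Γ ⊢ app M N
    wf-tup  : ∀ {Γ Ms} → 2 ≤ length Ms → Γ ⊢* Ms → Γ ⊢ tup Ms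
    wf-lam! : ∀ {Γ M} → (ω ◂ Γ) ⊢ M → Γ ⊢ lam! M
    wf-lamx : ∀ {Γ M} → (𝟙 ◂ Γ) ⊢ M → Γ ⊢ lam pvar M
    wf-lamp : ∀ {Γ k M} → (k ◂^ Γ) ⊢ M → Γ ⊢ lam (ptup k) M

  data _⊢*_ : Ctx → List Term → Set where
    wf-nil  : ∀ {Γ} → BangCtx Γ → Γ ⊢* []
    wf-cons : ∀ {Γ Γ₁ Γ₂ M Ms} → Γ ≔ Γ₁ ⊕ Γ₂ → Γ₁ ⊢ M → Γ₂ ⊢* Ms → Γ ⊢* (M ∷ Ms)

record QSetup : Set₁ where
  field
    amp   : CommutativeRing 0ℓ 0ℓ            -- stands for ℂ
    arity : ℕ → ℕ
    U     : (i : ℕ) → Vec Bool (arity i) → Vec Bool (arity i)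
          → CommutativeRing.Carrier amp      -- matrix of U_i (row, column)

module _ (S : QSetup) where
  open QSetup S
  open CommutativeRing amp using (Carrier; 0#; 1#) renaming (_+_ to _⊹_; _*_ to _⊛_)

  -- basis states {0,1}^QV and quantum registers {0,1}^QV → ℂ
  Assign : List ℕ → Set
  Assign QV = (r : ℕ) → r ∈ QV → Bool

  State : List ℕ → Set
  State QV = Assign QV → Carrier

  sumBits : (n : ℕ) → (Vec Bool n → Carrier) → Carrier
  sumBits zero    g = g []
  sumBits (suc n) g = sumBits n (λ v → g (false ∷ v)) ⊹ sumBits n (λ v → g (true ∷ v))

  updV : ∀ {QV n} → Vec ℕ n → Vec Bool n → Assign QV → Assign QV
  updV []       []       f = f
  updV (r ∷ rs) (b ∷ bs) f r' p with r' N.≟ r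
  ... | yes _ = b
  ... | no  _ = updV rs bs f r' p

  applyU : ∀ {QV} (i : ℕ) (rs : Vec ℕ (arity i))
         → (∀ k → lookup rs k ∈ QV) → State QV → State QV
  applyU i rs ps Q f =
    sumBits (arity i) (λ b' → U i (tabulate (λ k → f (lookup rs k) (ps k))) b' ⊛ Q (updV rs b' f))

  -- Q ⊗ |r ↦ c⟩
  extend : ∀ {QV} → State QV → (r : ℕ) → Bool → State (r ∷ QV)
  extend Q r c f = (if f r (here refl) xor c then 0# else 1#) ⊛ Q (λ r' p → f r' (there p))

  record Config : Set where
    constructor ⟦_,_,_⟧
    field
      QV   : List ℕ
      Q    : State QV
      term : Term

  WFConfig : Config → Set
  WFConfig ⟦ QV , Q , M ⟧ =
    Unique QV × Σ Ctx (λ Γ → (Γ ⊢ M) × (∀ r → qu Γ r ≡ true → r ∈ QV))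

  data Label : Set where
    Uq new l-β q-β c-β l-cm r-cm : Label

  constBit : Term → Bool → Set
  constBit c0 b = b ≡ false
  constBit c1 b = b ≡ true
  constBit _  b = Data.Empty.⊥
    where import Data.Empty

  data _⟶[_]_ : Config → Label → Config → Set where
    r-Uq   : ∀ {QV Q} i (rs : Vec ℕ (arity i)) (ps : ∀ k → lookup rs k ∈ QV)
           → ⟦ QV , Q , app (gate i) (qargs (toList rs)) ⟧ ⟶[ Uq ]
             ⟦ QV , applyU i rs ps Q , qargs (toList rs) ⟧
    r-new  : ∀ {QV Q c b} r → constBit c b → r ∉ QV
           → ⟦ QV , Q , new c ⟧ ⟶[ new ] ⟦ r ∷ QV , extend Q r b , qvar r ⟧
    r-lβ   : ∀ {QV Q M N}
           → ⟦ QV , Q , app (lam pvar M) N ⟧ ⟶[ l-β ] ⟦ QV , Q , sub (sub0 N) M ⟧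
    r-qβ   : ∀ {QV Q M} (rs : List ℕ)
           → ⟦ QV , Q , app (lam (ptup (length rs)) M) (qtuple rs) ⟧ ⟶[ q-β ]
             ⟦ QV , Q , sub (qsub rs) M ⟧
    r-cβ   : ∀ {QV Q M N}
           → ⟦ QV , Q , app (lam! M) (bang N) ⟧ ⟶[ c-β ] ⟦ QV , Q , sub (sub0 N) M ⟧
    r-lcm  : ∀ {QV Q L π M N}
           → ⟦ QV , Q , app L (app (lam π M) N) ⟧ ⟶[ l-cm ]
             ⟦ QV , Q , app (lam π (app (ren (arityP π +_) L) M)) N ⟧
    r-rcm  : ∀ {QV Q L π M N}
           → ⟦ QV , Q , app (app (lam π M) N) L ⟧ ⟶[ r-cm ]
             ⟦ QV , Q , app (lam π (app M (ren (arityP π +_) L))) N ⟧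
    -- closure under contexts (not under !, λ!x or new)
    c-appL : ∀ {QV Q M QV' Q' M' α N}
           → ⟦ QV , Q , M ⟧ ⟶[ α ] ⟦ QV' , Q' , M' ⟧
           → ⟦ QV , Q , app M N ⟧ ⟶[ α ] ⟦ QV' , Q' , app M' N ⟧
    c-appR : ∀ {QV Q M QV' Q' M' α N}
           → ⟦ QV , Q , M ⟧ ⟶[ α ] ⟦ QV' , Q' , M' ⟧
           → ⟦ QV , Q , app N M ⟧ ⟶[ α ] ⟦ QV' , Q' , app N M' ⟧
    c-tup  : ∀ {QV Q M QV' Q' M' α} Ms Ns
           → ⟦ QV , Q , M ⟧ ⟶[ α ] ⟦ QV' , Q' , M' ⟧
           → ⟦ QV , Q , tup (Ms ++ M ∷ Ns) ⟧ ⟶[ α ] ⟦ QV' , Q' , tup (Ms ++ M' ∷ Ns) ⟧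
    c-lam  : ∀ {QV Q M QV' Q' M' α π}
           → ⟦ QV , Q , M ⟧ ⟶[ α ] ⟦ QV' , Q' , M' ⟧
           → ⟦ QV , Q , lam π M ⟧ ⟶[ α ] ⟦ QV' , Q' , lam π M' ⟧

  data InQ : Label → Set where
    inUq : InQ Uq
    inqβ : InQ q-β

  _⟶Q_ : Config → Config → Set
  C ⟶Q C' = Σ Label (λ α → InQ α × (C ⟶[ α ] C'))

  EQT : Config → Set
  EQT C = ∀ α C' → C ⟶[ α ] C' → InQ α

-- A configuration is essentially quantum exactly when its term has no redex of a
-- non-quantum rule (new, l.β, c.β, l.cm, r.cm) in a reducible position: such a redex
-- always fires, a fresh qubit name being available, and every other step is labelled
-- Uq or q.β. This criterion does not look at the quantum register, so it remains to
-- see that Uq and q.β steps create no such redex. Uq produces qubit names only, and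
-- q.β substitutes qubit names for variables, which cannot produce a constant, an
-- abstraction, a ! or a β-redex. Under a context, a subterm turns into an abstraction
-- only by firing a q.β redex, and that β-redex, in function (argument) position of an
-- application, already formed an r.cm (l.cm) redex.
module Submission where

open import Defs
open import Data.Nat using (ℕ; zero; suc)
open import Data.Nat.Properties using (1+n≰n)
open import Data.List using (List; []; _∷_; _++_)
open import Data.List.Extrema.Nat using (max; xs≤max)
import Data.List.Relation.Unary.All as All
open import Data.List.Relation.Unary.Any using (Any; here; there; satisfied)
open import Data.List.Relation.Unary.Any.Properties using (map⁻; ++⁺ʳ)
open import Data.List.Membership.Propositional using (_∉_; find)
open import Data.List.Membership.Propositional.Properties using (∈-∃++)
open import Data.Vec using (toList)
open import Data.Product using (_,_)
open import Data.Sum using (_⊎_; inj₁; inj₂)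
open import Data.Empty using (⊥-elim)
open import Relation.Nullary using (¬_; Dec; yes; no)
open import Relation.Nullary.Decidable using (decidable-stable)
open import Relation.Binary.PropositionalEquality using (refl)

data IsAtom : Term → Set where
  is-var  : ∀ {i} → IsAtom (var i)
  is-qvar : ∀ {r} → IsAtom (qvar r)

Atomic : (ℕ → Term) → Set
Atomic σ = ∀ i → IsAtom (σ i)

IsAtom-ren : ∀ ρ {M} → IsAtom M → IsAtom (ren ρ M)
IsAtom-ren ρ is-var  = is-var
IsAtom-ren ρ is-qvar = is-qvar

Atomic-lifts : ∀ k {σ} → Atomic σ → Atomic (lifts k σ)
Atomic-lifts zero    a i       = a i
Atomic-lifts (suc k) a zero    = is-var
Atomic-lifts (suc k) a (suc i) = IsAtom-ren suc (Atomic-lifts k a i)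

Atomic-qsub : ∀ rs → Atomic (qsub rs)
Atomic-qsub []       i       = is-var
Atomic-qsub (r ∷ rs) zero    = is-qvar
Atomic-qsub (r ∷ rs) (suc i) = Atomic-qsub rs i

data Shape : Set where
  constant bang-abstraction banged β-redex : Shape
  abstraction : Pat → Shape

data HasShape : Shape → Term → Set where
  is-c0   : HasShape constant c0
  is-c1   : HasShape constant c1
  is-lam  : ∀ {π M} → HasShape (abstraction π) (lam π M)
  is-lam! : ∀ {M} → HasShape bang-abstraction (lam! M)
  is-bang : ∀ {M} → HasShape banged (bang M)
  is-β    : ∀ {π A B} → HasShape (abstraction π) A → HasShape β-redex (app A B)

data NonQRedex : Term → Set where
  new-redex : ∀ {c} → HasShape constant c → NonQRedex (new c)
  lβ-redex  : ∀ {A B} → HasShape (abstraction pvar) A → NonQRedex (app A B)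
  cβ-redex  : ∀ {A B} → HasShape bang-abstraction A → HasShape banged B → NonQRedex (app A B)
  lcm-redex : ∀ {A B} → HasShape β-redex B → NonQRedex (app A B)
  rcm-redex : ∀ {A B} → HasShape β-redex A → NonQRedex (app A B)

-- The positions are those of the closure rules of reduction: never under !, λ!x or new.
data HasNonQRedex : Term → Set where
  at-top  : ∀ {M} → NonQRedex M → HasNonQRedex M
  in-appˡ : ∀ {A B} → HasNonQRedex A → HasNonQRedex (app A B)
  in-appʳ : ∀ {A B} → HasNonQRedex B → HasNonQRedex (app A B)
  in-tup  : ∀ {Ms} → Any HasNonQRedex Ms → HasNonQRedex (tup Ms)
  in-lam  : ∀ {π M} → HasNonQRedex M → HasNonQRedex (lam π M)

IsAtom⇒¬HasShape : ∀ {s M} → IsAtom M → ¬ HasShape s M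
IsAtom⇒¬HasShape is-var  ()
IsAtom⇒¬HasShape is-qvar ()

IsAtom⇒¬HasNonQRedex : ∀ {M} → IsAtom M → ¬ HasNonQRedex M
IsAtom⇒¬HasNonQRedex is-var  (at-top ())
IsAtom⇒¬HasNonQRedex is-qvar (at-top ())

HasShape-sub⁻ : ∀ {σ s} → Atomic σ → ∀ M → HasShape s (sub σ M) → HasShape s M
HasShape-sub⁻ a (var i)   h        = ⊥-elim (IsAtom⇒¬HasShape (a i) h)
HasShape-sub⁻ a c0        is-c0    = is-c0
HasShape-sub⁻ a c1        is-c1    = is-c1
HasShape-sub⁻ a (lam π M) is-lam   = is-lam
HasShape-sub⁻ a (lam! M)  is-lam!  = is-lam!
HasShape-sub⁻ a (bang M)  is-bang  = is-bang
HasShape-sub⁻ a (app A B) (is-β h) = is-β (HasShape-sub⁻ a A h)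

NonQRedex-sub⁻ : ∀ {σ} → Atomic σ → ∀ M → NonQRedex (sub σ M) → NonQRedex M
NonQRedex-sub⁻ a (var i)   r =
  ⊥-elim (IsAtom⇒¬HasNonQRedex (a i) (at-top r))
NonQRedex-sub⁻ a (new M)   (new-redex h)   = new-redex (HasShape-sub⁻ a M h)
NonQRedex-sub⁻ a (app A B) (lβ-redex h)    = lβ-redex (HasShape-sub⁻ a A h)
NonQRedex-sub⁻ a (app A B) (cβ-redex h h') =
  cβ-redex (HasShape-sub⁻ a A h) (HasShape-sub⁻ a B h')
NonQRedex-sub⁻ a (app A B) (lcm-redex h)   = lcm-redex (HasShape-sub⁻ a B h)
NonQRedex-sub⁻ a (app A B) (rcm-redex h)   = rcm-redex (HasShape-sub⁻ a A h)

mutual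
  HasNonQRedex-sub⁻ : ∀ {σ} → Atomic σ → ∀ M → HasNonQRedex (sub σ M) → HasNonQRedex M
  HasNonQRedex-sub⁻ a (var i)   h           = ⊥-elim (IsAtom⇒¬HasNonQRedex (a i) h)
  HasNonQRedex-sub⁻ a M         (at-top r)  = at-top (NonQRedex-sub⁻ a M r)
  HasNonQRedex-sub⁻ a (app A B) (in-appˡ h) = in-appˡ (HasNonQRedex-sub⁻ a A h)
  HasNonQRedex-sub⁻ a (app A B) (in-appʳ h) = in-appʳ (HasNonQRedex-sub⁻ a B h)
  HasNonQRedex-sub⁻ a (tup Ms)  (in-tup h)  = in-tup (Any-HasNonQRedex-subL⁻ a Ms h)
  HasNonQRedex-sub⁻ a (lam π M) (in-lam h)  =
    in-lam (HasNonQRedex-sub⁻ (Atomic-lifts (arityP π) a) M h)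

  Any-HasNonQRedex-subL⁻ : ∀ {σ} → Atomic σ → ∀ Ms
                         → Any HasNonQRedex (subL σ Ms) → Any HasNonQRedex Ms
  Any-HasNonQRedex-subL⁻ a (M ∷ Ms) (here h)  = here (HasNonQRedex-sub⁻ a M h)
  Any-HasNonQRedex-subL⁻ a (M ∷ Ms) (there h) = there (Any-HasNonQRedex-subL⁻ a Ms h)

qargs⇒¬HasShape : ∀ {s} rs → ¬ HasShape s (qargs rs)
qargs⇒¬HasShape []            ()
qargs⇒¬HasShape (r ∷ [])      ()
qargs⇒¬HasShape (r ∷ r' ∷ rs) ()

qtuple⇒¬HasNonQRedex : ∀ rs → ¬ HasNonQRedex (qtuple rs)
qtuple⇒¬HasNonQRedex rs (in-tup h) with satisfied (map⁻ h)
... | _ , h' = IsAtom⇒¬HasNonQRedex is-qvar h'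

qargs⇒¬HasNonQRedex : ∀ rs → ¬ HasNonQRedex (qargs rs)
qargs⇒¬HasNonQRedex []            = qtuple⇒¬HasNonQRedex []
qargs⇒¬HasNonQRedex (r ∷ [])      = IsAtom⇒¬HasNonQRedex is-qvar
qargs⇒¬HasNonQRedex (r ∷ r' ∷ rs) = qtuple⇒¬HasNonQRedex (r ∷ r' ∷ rs)

Any-replace : ∀ {A : Set} {P : A → Set} {x y zs} → (P y → P x)
            → ∀ xs → Any P (xs ++ y ∷ zs) → Any P (xs ++ x ∷ zs)
Any-replace f []       (here p)  = here (f p)
Any-replace f []       (there p) = there p
Any-replace f (_ ∷ xs) (here p)  = here p
Any-replace f (_ ∷ xs) (there p) = there (Any-replace f xs p)

fresh : List ℕ → ℕ
fresh QV = suc (max 0 QV)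

fresh∉ : ∀ QV → fresh QV ∉ QV
fresh∉ QV r∈QV = 1+n≰n (All.lookup (xs≤max 0 QV) r∈QV)

module _ (S : QSetup) where

  private
    infix 4 _⟶⟨_⟩_
    _⟶⟨_⟩_ : Config S → Label S → Config S → Set
    _⟶⟨_⟩_ = _⟶[_]_ S

  InQ? : ∀ α → Dec (InQ S α)
  InQ? Uq   = yes inUq
  InQ? q-β  = yes inqβ
  InQ? new  = no λ ()
  InQ? l-β  = no λ ()
  InQ? c-β  = no λ ()
  InQ? l-cm = no λ ()
  InQ? r-cm = no λ ()

  constBit⇒constant : ∀ {c b} → constBit S c b → HasShape constant c
  constBit⇒constant {c0} _ = is-c0
  constBit⇒constant {c1} _ = is-c1

  nonQStep⇒HasNonQRedex : ∀ {α QV Q M C'} → ¬ InQ S α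
                        → ⟦ QV , Q , M ⟧ ⟶⟨ α ⟩ C' → HasNonQRedex M
  nonQStep⇒HasNonQRedex nq (r-Uq i rs ps)  = ⊥-elim (nq inUq)
  nonQStep⇒HasNonQRedex nq (r-qβ rs)       = ⊥-elim (nq inqβ)
  nonQStep⇒HasNonQRedex nq (r-new r c↦b _) = at-top (new-redex (constBit⇒constant c↦b))
  nonQStep⇒HasNonQRedex nq r-lβ            = at-top (lβ-redex is-lam)
  nonQStep⇒HasNonQRedex nq r-cβ            = at-top (cβ-redex is-lam! is-bang)
  nonQStep⇒HasNonQRedex nq r-lcm           = at-top (lcm-redex (is-β is-lam))
  nonQStep⇒HasNonQRedex nq r-rcm           = at-top (rcm-redex (is-β is-lam))
  nonQStep⇒HasNonQRedex nq (c-appL s)      = in-appˡ (nonQStep⇒HasNonQRedex nq s)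
  nonQStep⇒HasNonQRedex nq (c-appR s)      = in-appʳ (nonQStep⇒HasNonQRedex nq s)
  nonQStep⇒HasNonQRedex nq (c-tup Ms _ s)  =
    in-tup (++⁺ʳ Ms (here (nonQStep⇒HasNonQRedex nq s)))
  nonQStep⇒HasNonQRedex nq (c-lam s)       = in-lam (nonQStep⇒HasNonQRedex nq s)

  ¬HasNonQRedex⇒EQT : ∀ {QV Q M} → ¬ HasNonQRedex M → EQT S ⟦ QV , Q , M ⟧
  ¬HasNonQRedex⇒EQT ¬h α C' s =
    decidable-stable (InQ? α) (λ nq → ¬h (nonQStep⇒HasNonQRedex nq s))

  nonQStep⇒¬EQT : ∀ {α C C'} → ¬ InQ S α → C ⟶⟨ α ⟩ C' → ¬ EQT S C
  nonQStep⇒¬EQT nq s eqt = nq (eqt _ _ s)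

  NonQRedex⇒¬EQT : ∀ {QV Q M} → NonQRedex M → ¬ EQT S ⟦ QV , Q , M ⟧
  NonQRedex⇒¬EQT {QV} (new-redex is-c0) =
    nonQStep⇒¬EQT (λ ()) (r-new (fresh QV) refl (fresh∉ QV))
  NonQRedex⇒¬EQT {QV} (new-redex is-c1) =
    nonQStep⇒¬EQT (λ ()) (r-new (fresh QV) refl (fresh∉ QV))
  NonQRedex⇒¬EQT (lβ-redex is-lam)         = nonQStep⇒¬EQT (λ ()) r-lβ
  NonQRedex⇒¬EQT (cβ-redex is-lam! is-bang) = nonQStep⇒¬EQT (λ ()) r-cβ
  NonQRedex⇒¬EQT (lcm-redex (is-β is-lam))  = nonQStep⇒¬EQT (λ ()) r-lcm
  NonQRedex⇒¬EQT (rcm-redex (is-β is-lam))  = nonQStep⇒¬EQT (λ ()) r-rcm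

  ¬EQT-tup⁺ : ∀ {QV Q Ms} → Any (λ M → ¬ EQT S ⟦ QV , Q , M ⟧) Ms
            → ¬ EQT S ⟦ QV , Q , tup Ms ⟧
  ¬EQT-tup⁺ h eqt with find h
  ... | M , M∈Ms , ¬eqt with ∈-∃++ M∈Ms
  ... | Ls , Ns , refl = ¬eqt (λ α C' s → eqt α _ (c-tup Ls Ns s))

  mutual
    HasNonQRedex⇒¬EQT : ∀ {QV Q M} → HasNonQRedex M → ¬ EQT S ⟦ QV , Q , M ⟧
    HasNonQRedex⇒¬EQT (at-top r)      = NonQRedex⇒¬EQT r
    HasNonQRedex⇒¬EQT (in-appˡ h) eqt = HasNonQRedex⇒¬EQT h (λ α C' s → eqt α _ (c-appL s))
    HasNonQRedex⇒¬EQT (in-appʳ h) eqt = HasNonQRedex⇒¬EQT h (λ α C' s → eqt α _ (c-appR s))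
    HasNonQRedex⇒¬EQT (in-lam h)  eqt = HasNonQRedex⇒¬EQT h (λ α C' s → eqt α _ (c-lam s))
    HasNonQRedex⇒¬EQT (in-tup h)      = ¬EQT-tup⁺ (Any-HasNonQRedex⇒¬EQT h)

    Any-HasNonQRedex⇒¬EQT : ∀ {QV Q Ms} → Any HasNonQRedex Ms
                          → Any (λ M → ¬ EQT S ⟦ QV , Q , M ⟧) Ms
    Any-HasNonQRedex⇒¬EQT (here h)  = here (HasNonQRedex⇒¬EQT h)
    Any-HasNonQRedex⇒¬EQT (there h) = there (Any-HasNonQRedex⇒¬EQT h)

  HasShape-step⁻ : ∀ {α QV Q M QV' Q' M' s}
                 → InQ S α → ⟦ QV , Q , M ⟧ ⟶⟨ α ⟩ ⟦ QV' , Q' , M' ⟧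
                 → HasShape s M' → HasShape s M ⊎ HasShape β-redex M ⊎ HasNonQRedex M
  HasShape-step⁻ inUq (r-Uq i rs ps) h = ⊥-elim (qargs⇒¬HasShape (toList rs) h)
  HasShape-step⁻ inqβ (r-qβ rs)      h = inj₂ (inj₁ (is-β is-lam))
  HasShape-step⁻ q (c-appL s) (is-β h) with HasShape-step⁻ q s h
  ... | inj₁ h'        = inj₁ (is-β h')
  ... | inj₂ (inj₁ β)  = inj₂ (inj₂ (at-top (rcm-redex β)))
  ... | inj₂ (inj₂ h') = inj₂ (inj₂ (in-appˡ h'))
  HasShape-step⁻ q (c-appR s)     (is-β h) = inj₁ (is-β h)
  HasShape-step⁻ q (c-lam s)      is-lam   = inj₁ is-lam

  HasShape-appˡ-step⁻ : ∀ {α QV Q QV' Q' A A' B s}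
                      → InQ S α → ⟦ QV , Q , A ⟧ ⟶⟨ α ⟩ ⟦ QV' , Q' , A' ⟧
                      → HasShape s A' → (HasShape s A → NonQRedex (app A B))
                      → HasNonQRedex (app A B)
  HasShape-appˡ-step⁻ q step h redex with HasShape-step⁻ q step h
  ... | inj₁ h'        = at-top (redex h')
  ... | inj₂ (inj₁ β)  = at-top (rcm-redex β)
  ... | inj₂ (inj₂ h') = in-appˡ h'

  HasShape-appʳ-step⁻ : ∀ {α QV Q QV' Q' A A' B s}
                      → InQ S α → ⟦ QV , Q , A ⟧ ⟶⟨ α ⟩ ⟦ QV' , Q' , A' ⟧
                      → HasShape s A' → (HasShape s A → NonQRedex (app B A))
                      → HasNonQRedex (app B A)
  HasShape-appʳ-step⁻ q step h redex with HasShape-step⁻ q step h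
  ... | inj₁ h'        = at-top (redex h')
  ... | inj₂ (inj₁ β)  = at-top (lcm-redex β)
  ... | inj₂ (inj₂ h') = in-appʳ h'

  HasNonQRedex-step⁻ : ∀ {α QV Q M QV' Q' M'}
                     → InQ S α → ⟦ QV , Q , M ⟧ ⟶⟨ α ⟩ ⟦ QV' , Q' , M' ⟧
                     → HasNonQRedex M' → HasNonQRedex M
  HasNonQRedex-step⁻ inUq (r-Uq i rs ps) h = ⊥-elim (qargs⇒¬HasNonQRedex (toList rs) h)
  HasNonQRedex-step⁻ inqβ (r-qβ {M = M} rs) h =
    in-appˡ (in-lam (HasNonQRedex-sub⁻ (Atomic-qsub rs) M h))
  HasNonQRedex-step⁻ q (c-appL s) (at-top (lβ-redex h))    = HasShape-appˡ-step⁻ q s h lβ-redex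
  HasNonQRedex-step⁻ q (c-appL s) (at-top (cβ-redex h h')) =
    HasShape-appˡ-step⁻ q s h (λ h → cβ-redex h h')
  HasNonQRedex-step⁻ q (c-appL s) (at-top (lcm-redex h))   = at-top (lcm-redex h)
  HasNonQRedex-step⁻ q (c-appL s) (at-top (rcm-redex h))   = HasShape-appˡ-step⁻ q s h rcm-redex
  HasNonQRedex-step⁻ q (c-appL s) (in-appˡ h)              = in-appˡ (HasNonQRedex-step⁻ q s h)
  HasNonQRedex-step⁻ q (c-appL s) (in-appʳ h)              = in-appʳ h
  HasNonQRedex-step⁻ q (c-appR s) (at-top (lβ-redex h))    = at-top (lβ-redex h)
  HasNonQRedex-step⁻ q (c-appR s) (at-top (cβ-redex h h')) =
    HasShape-appʳ-step⁻ q s h' (cβ-redex h)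
  HasNonQRedex-step⁻ q (c-appR s) (at-top (lcm-redex h))   = HasShape-appʳ-step⁻ q s h lcm-redex
  HasNonQRedex-step⁻ q (c-appR s) (at-top (rcm-redex h))   = at-top (rcm-redex h)
  HasNonQRedex-step⁻ q (c-appR s) (in-appˡ h)              = in-appˡ h
  HasNonQRedex-step⁻ q (c-appR s) (in-appʳ h)              = in-appʳ (HasNonQRedex-step⁻ q s h)
  HasNonQRedex-step⁻ q (c-tup Ms _ s) (in-tup h) =
    in-tup (Any-replace (HasNonQRedex-step⁻ q s) Ms h)
  HasNonQRedex-step⁻ q (c-lam s)      (in-lam h) = in-lam (HasNonQRedex-step⁻ q s h)

mainTheorem10 : (S : QSetup) (C C' : Config S) → WFConfig S C
                → EQT S C → _⟶Q_ S C C' → EQT S C'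
mainTheorem10 S ⟦ QV , Q , M ⟧ ⟦ QV' , Q' , M' ⟧ _ eqt (α , q , s) =
  ¬HasNonQRedex⇒EQT S λ h → HasNonQRedex⇒¬EQT S (HasNonQRedex-step⁻ S q s h) eqt
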